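{- Let $p$ be a prime and $A$ a $\mathbb{Z}_p$-valued sequence satisfying the $p$-Lucas property with $A(0)\in\mathbb{Z}_p^\times$. Assume that $f_A(z)=\sum_{n\ge0}A(n)z^n$ is annihilated by a differential operator $\mathcal{L}\in\mathbb{Z}_p[z,\theta]$ which either is of type I, or is of type II with $p-1\in\mathcal{Z}_p(A)$. Let $r\in\mathbb{N}$ be such that: for all $n,i\in\mathbb{N}$ with $i\le r$, if $\alpha_p(A,n)\ge i$ then $A(n)\in p^i\mathbb{Z}_p$. Then for every $n_0\in\mathcal{Z}_p(A)$ and every $m\in\mathbb{N}$ with $\alpha_p(A,m)\ge r$, we have $A(n_0+mp)\in p^{r+1}\mathbb{Z}_p$.
   Context: Sequences are extended by $0$ at negative indices. $A$ satisfies the $p$-Lucas property if $A(v+np)\equiv A(v)A(n)\pmod{p\mathbb{Z}_p}$ for all $v\in\{0,\dots,p-1\}$, $n\in\mathbb{N}$. $\mathcal{Z}_p(A)$ is the set of $v\in\{0,\dots,p-1\}$ with $A(v)\in p\mathbb{Z}_p$; for $n=\sum_{k=0}^Nn_kp^k$ in base $p$ ($n_N\ne0$; for $n=0$ the single digit $0$), $\alpha_p(A,n)$ is the number of $k$ with $n_k\in\mathcal{Z}_p(A)$. $\theta=z\frac{d}{dz}$. An operator $\mathcal{L}=\sum_{k=0}^q z^kP_k(\theta)$ with $P_k\in\mathbb{Z}_p[X]$ is of type I if $P_0(\mathbb{Z}_p^\times)\subset\mathbb{Z}_p^\times$ and $P_k(X)\in\prod_{i=1}^{k-1}(X+i)^2\,\mathbb{Z}_p[X]$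 for all $k\in\{2,\dots,q\}$; it is of type II if $q=2$, $P_0(\mathbb{Z}_p^\times)\subset\mathbb{Z}_p^\times$ and $P_2(X)\in(X+1)\mathbb{Z}_p[X]$. -}

module Defs where

open import Data.Nat using (ℕ; zero; suc; _+_; _*_; _∸_; _^_; _≤_; _<_; _%_; _/_; _<ᵇ_)
open import Data.Nat.Primality using (Prime) public
open import Data.Nat.Properties using (_≟_)
open import Data.List using (List; []; _∷_; length; filter; map; foldr)
open import Data.Bool using (if_then_else_)
open import Data.Product using (Σ; _×_; _,_)
open import Relation.Binary.PropositionalEquality using (_≡_; _≢_)
open import Relation.Nullary using (¬_)

-- Elementary helpers (divisor 0 never occurs below since p is prime)

_mod′_ : ℕ → ℕ → ℕ
m mod′ zero    = m
m mod′ (suc n) = m % suc n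

_div′_ : ℕ → ℕ → ℕ
m div′ zero    = zero
m div′ (suc n) = m / suc n

-- p-adic integers ℤ_p, represented as the inverse limit of ℤ/p^kℤ:
-- x k ∈ {0,…,p^k-1} is the residue of x modulo p^k.

Zp : Set
Zp = ℕ → ℕ

ValidZp : ℕ → Zp → Set
ValidZp p x = (k : ℕ) → (x k < p ^ k) × ((x (suc k)) mod′ (p ^ k) ≡ x k)

_≈ₚ_ : Zp → Zp → Set
x ≈ₚ y = (k : ℕ) → x k ≡ y k

0ₚ : Zp
0ₚ _ = 0

module _ (p : ℕ) where

  ιₚ : ℕ → Zp
  ιₚ n k = n mod′ (p ^ k)

  1ₚ : Zp
  1ₚ = ιₚ 1

  _+ₚ_ : Zp → Zp → Zp
  (x +ₚ y) k = (x k + y k) mod′ (p ^ k)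

  _*ₚ_ : Zp → Zp → Zp
  (x *ₚ y) k = (x k * y k) mod′ (p ^ k)

  InPowIdeal : ℕ → Zp → Set
  InPowIdeal i x = x i ≡ 0

  IsUnit : Zp → Set
  IsUnit x = ¬ (x 1 ≡ 0)

  CongP : Zp → Zp → Set
  CongP x y = x 1 ≡ y 1

  -- Polynomials in ℤ_p[X], as coefficient lists (constant term first)

  Poly : Set
  Poly = List Zp

  ValidPoly : Poly → Set
  ValidPoly []       = Data.Unit.⊤ where import Data.Unit
  ValidPoly (c ∷ cs) = ValidZp p c × ValidPoly cs

  coeff : Poly → ℕ → Zp
  coeff []       _       = 0ₚ
  coeff (c ∷ cs) zero    = c
  coeff (c ∷ cs) (suc j) = coeff cs j

  _≈P_ : Poly → Poly → Set
  P ≈P Q = (j : ℕ) → coeff P j ≈ₚ coeff Q j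

  addP : Poly → Poly → Poly
  addP []       Q        = Q
  addP (a ∷ P)  []       = a ∷ P
  addP (a ∷ P)  (b ∷ Q)  = (a +ₚ b) ∷ addP P Q

  mulP : Poly → Poly → Poly
  mulP []      Q = []
  mulP (a ∷ P) Q = addP (map (a *ₚ_) Q) (0ₚ ∷ mulP P Q)

  DividesP : Poly → Poly → Set
  DividesP P R = Σ Poly λ Q → ValidPoly Q × (R ≈P mulP P Q)

  evalP : Poly → Zp → Zp
  evalP []       u = 0ₚ
  evalP (c ∷ cs) u = c +ₚ (u *ₚ evalP cs u)

  X+ : ℕ → Poly
  X+ i = ιₚ i ∷ 1ₚ ∷ []

  -- ∏_{i=1}^{k-1} (X+i)^2
  prodSq : ℕ → Poly
  prodSq zero          = 1ₚ ∷ []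
  prodSq (suc zero)    = 1ₚ ∷ []
  prodSq (suc (suc k)) = mulP (prodSq (suc k)) (mulP (X+ (suc k)) (X+ (suc k)))

  PreservesUnits : Poly → Set
  PreservesUnits P = (u : Zp) → ValidZp p u → IsUnit u → IsUnit (evalP P u)

  -- Formal power series in ℤ_p[[z]] (n ↦ coefficient of z^n),
  -- and the action of ℤ_p[z, θ], θ = z d/dz.

  Series : Set
  Series = ℕ → Zp

  θ : Series → Series
  θ f n = ιₚ n *ₚ f n

  zpow : ℕ → Series → Series
  zpow k f n = if n <ᵇ k then 0ₚ else f (n ∸ k)

  -- P(θ) f  = c₀ f + θ (c₁ f + θ (…)), using θ(z^n) = n z^n
  applyPθ : Poly → Series → Series
  applyPθ []       f n = 0ₚ
  applyPθ (c ∷ cs) f n = (c *ₚ f n) +ₚ θ (applyPθ cs f) n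

  -- L f  with L = Σ_{k=0}^{q} z^k P_k(θ)
  applyL : ℕ → (ℕ → Poly) → Series → Series
  applyL zero    P f n = zpow 0 (applyPθ (P 0) f) n
  applyL (suc q) P f n = applyL q P f n +ₚ zpow (suc q) (applyPθ (P (suc q)) f) n

  Annihilates : ℕ → (ℕ → Poly) → Series → Set
  Annihilates q P f = (n : ℕ) → applyL q P f n ≈ₚ 0ₚ

  TypeI : ℕ → (ℕ → Poly) → Set
  TypeI q P = PreservesUnits (P 0) ×
              ((k : ℕ) → 2 ≤ k → k ≤ q → DividesP (prodSq k) (P k))

  TypeII : ℕ → (ℕ → Poly) → Set
  TypeII q P = (q ≡ 2) × PreservesUnits (P 0) × DividesP (X+ 1) (P 2)

  LucasProperty : (ℕ → Zp) → Set
  LucasProperty A = (v n : ℕ) → v < p → CongP (A (v + n * p)) (A v *ₚ A n)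

  InZ : (ℕ → Zp) → ℕ → Set
  InZ A v = (v < p) × InPowIdeal 1 (A v)

  -- base-p digits of n, least significant first; digits of 0 is [0]
  digitsFuel : ℕ → ℕ → List ℕ
  digitsFuel zero     n = []
  digitsFuel (suc fu) n = if n <ᵇ p then n ∷ [] else (n mod′ p) ∷ digitsFuel fu (n div′ p)

  digits : ℕ → List ℕ
  digits n = digitsFuel (suc n) n

  α : (ℕ → Zp) → ℕ → ℕ
  α A n = length (filter (λ d → A d 1 ≟ 0) (digits n))

-- Let K = r + 1 and let Y n be the residue of A n modulo p^K. Annihilation by L says
-- that Y satisfies the linear recurrence Σ_k P_k(n − k) Y(n − k) ≡ 0 mod p^K, whose
-- leading coefficient P_0(j) is a unit for 0 < j < p. For 0 < j < p the block
-- X i = Y(i + mp) satisfies the same recurrence: a shift by mp changes P_k(·) only by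
-- multiples of p while p^r divides every X i (the digits of m are digits of i + mp),
-- and the terms reaching below mp vanish because of the factor ∏ (θ + i)² (type I),
-- resp. θ + 1 together with p − 1 ∈ 𝒵 (type II). Two solutions of such a recurrence
-- are proportional on [0, p): X j Y 0 ≡ X 0 Y j. For j = n₀ ∈ 𝒵 the right-hand side
-- is divisible by p^r · p, and Y 0 is a unit.

module Submission where

open import Defs
open import Data.Nat using (ℕ; zero; suc; _+_; _*_; _∸_; _^_; _≤_; _<_; _≥_; _%_; _/_; _<ᵇ_; _≡ᵇ_; z≤n; s≤s; z<s; NonZero; >-nonZero; nonTrivial⇒n>1)
open import Data.Nat.Properties using (_≟_)
import Data.Nat.Properties as ℕ
import Data.Nat.DivMod as ℕ
import Data.Nat.Divisibility as ℕ
open import Data.Nat.Induction using (<-rec)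
open import Data.Nat.Primality using (euclidsLemma; prime⇒nonZero; prime⇒nonTrivial)
open import Data.Integer using (ℤ; +_) renaming (_+_ to _+ᶻ_; _*_ to _*ᶻ_; _-_ to _-ᶻ_; -_ to -ᶻ_)
import Data.Integer.Properties as ℤ
open import Data.Integer.Divisibility.Signed using (_∣_; divides; ∣-refl; ∣-trans; ∣ᵤ⇒∣; ∣⇒∣ᵤ; ∣m⇒∣-m; ∣m∣n⇒∣m+n; ∣n⇒∣m*n; ∣m⇒∣m*n)
open import Data.Integer.Tactic.RingSolver using (solve-∀)
open import Data.Nat.Tactic.RingSolver using () renaming (solve-∀ to ℕ-solve-∀)
open import Data.List using (List; []; _∷_; map; length; filter)
open import Data.Bool using (true; false; T; if_then_else_)
open import Data.Unit using (tt)
open import Data.Product using (Σ; _×_; _,_; proj₁; proj₂)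
open import Data.Sum using (_⊎_; inj₁; inj₂; [_,_]′)
open import Data.Empty using (⊥-elim)
open import Relation.Nullary using (¬_; yes; no)
open import Function using (_∘_)
open import Relation.Binary.Bundles using (Setoid)
open import Relation.Binary.Structures using (IsEquivalence)
import Relation.Binary.Reasoning.Setoid as SetoidReasoning
open import Relation.Binary.PropositionalEquality using (_≡_; refl; sym; trans; cong; cong₂; subst; module ≡-Reasoning)

-- A record rather than + n ∣ a - b, so that a and b can be inferred from a proof.
infix 4 _≡_mod_
record _≡_mod_ (a b : ℤ) (n : ℕ) : Set where
  constructor ≡mod
  field ∣-diff : + n ∣ a -ᶻ b
open _≡_mod_

module _ {n : ℕ} where

  ≡mod-refl : ∀ {a} → a ≡ a mod n
  ≡mod-refl {a} = ≡mod (subst (_ ∣_) (sym (ℤ.+-inverseʳ a)) (divides (+ 0) (sym (ℤ.*-zeroˡ (+ n)))))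

  ≡⇒≡mod : ∀ {a b} → a ≡ b → a ≡ b mod n
  ≡⇒≡mod refl = ≡mod-refl

  ≡mod-sym : ∀ {a b} → a ≡ b mod n → b ≡ a mod n
  ≡mod-sym {a} {b} (≡mod d) = ≡mod (subst (_ ∣_) (eq a b) (∣m⇒∣-m d))
    where
      eq : ∀ a b → -ᶻ (a -ᶻ b) ≡ b -ᶻ a
      eq = solve-∀

  ≡mod-trans : ∀ {a b c} → a ≡ b mod n → b ≡ c mod n → a ≡ c mod n
  ≡mod-trans {a} {b} {c} (≡mod d) (≡mod e) = ≡mod (subst (_ ∣_) (eq a b c) (∣m∣n⇒∣m+n d e))
    where
      eq : ∀ a b c → (a -ᶻ b) +ᶻ (b -ᶻ c) ≡ a -ᶻ c
      eq = solve-∀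

  +-cong-mod : ∀ {a b c d} → a ≡ b mod n → c ≡ d mod n → a +ᶻ c ≡ b +ᶻ d mod n
  +-cong-mod {a} {b} {c} {d} (≡mod x) (≡mod y) = ≡mod (subst (_ ∣_) (eq a b c d) (∣m∣n⇒∣m+n x y))
    where
      eq : ∀ a b c d → (a -ᶻ b) +ᶻ (c -ᶻ d) ≡ (a +ᶻ c) -ᶻ (b +ᶻ d)
      eq = solve-∀

  *-cong-mod : ∀ {a b c d} → a ≡ b mod n → c ≡ d mod n → a *ᶻ c ≡ b *ᶻ d mod n
  *-cong-mod {a} {b} {c} {d} (≡mod x) (≡mod y) =
    ≡mod (subst (_ ∣_) (eq a b c d) (∣m∣n⇒∣m+n (∣m⇒∣m*n c x) (∣n⇒∣m*n b y)))
    where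
      eq : ∀ a b c d → (a -ᶻ b) *ᶻ c +ᶻ b *ᶻ (c -ᶻ d) ≡ a *ᶻ c -ᶻ b *ᶻ d
      eq = solve-∀

  +-congˡ-mod : ∀ a {c d} → c ≡ d mod n → a +ᶻ c ≡ a +ᶻ d mod n
  +-congˡ-mod a = +-cong-mod (≡mod-refl {a})

  +-congʳ-mod : ∀ c {a b} → a ≡ b mod n → a +ᶻ c ≡ b +ᶻ c mod n
  +-congʳ-mod c a≡b = +-cong-mod a≡b (≡mod-refl {c})

  *-congˡ-mod : ∀ a {c d} → c ≡ d mod n → a *ᶻ c ≡ a *ᶻ d mod n
  *-congˡ-mod a = *-cong-mod (≡mod-refl {a})

  neg-cong-mod : ∀ {a b} → a ≡ b mod n → -ᶻ a ≡ -ᶻ b mod n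
  neg-cong-mod {a} {b} (≡mod d) = ≡mod (subst (_ ∣_) (eq a b) (∣m⇒∣-m d))
    where
      eq : ∀ a b → -ᶻ (a -ᶻ b) ≡ -ᶻ a -ᶻ -ᶻ b
      eq = solve-∀

  ≡mod0⇒∣ : ∀ {a} → a ≡ + 0 mod n → + n ∣ a
  ≡mod0⇒∣ {a} (≡mod d) = subst (_ ∣_) (ℤ.+-identityʳ a) d

  ∣⇒≡mod0 : ∀ {a} → + n ∣ a → a ≡ + 0 mod n
  ∣⇒≡mod0 {a} d = ≡mod (subst (_ ∣_) (sym (ℤ.+-identityʳ a)) d)

  ≡mod-isEquivalence : IsEquivalence (λ a b → a ≡ b mod n)
  ≡mod-isEquivalence = record { refl = ≡mod-refl ; sym = ≡mod-sym ; trans = ≡mod-trans }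

  factor-≡mod0 : ∀ f {e g a} → e ≡ f *ᶻ g mod n → + n ∣ f *ᶻ a → e *ᶻ a ≡ + 0 mod n
  factor-≡mod0 f {e} {g} {a} e≡fg n∣fa =
    ≡mod-trans (*-cong-mod e≡fg (≡mod-refl {a})) (∣⇒≡mod0 (subst (_ ∣_) (eq f g a) (∣n⇒∣m*n g n∣fa)))
    where
      eq : ∀ f g a → g *ᶻ (f *ᶻ a) ≡ f *ᶻ g *ᶻ a
      eq = solve-∀

≡mod-setoid : ℕ → Setoid _ _
≡mod-setoid n = record { isEquivalence = ≡mod-isEquivalence {n} }

≡mod-weaken : ∀ {m n a b} → m ℕ.∣ n → a ≡ b mod n → a ≡ b mod m
≡mod-weaken m∣n (≡mod d) = ≡mod (∣-trans (∣ᵤ⇒∣ m∣n) d)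

%-≡mod : ∀ a n .{{_ : NonZero n}} → + (a % n) ≡ + a mod n
%-≡mod a n = ≡mod (divides (-ᶻ + (a / n)) (begin
    + (a % n) -ᶻ + a                             ≡⟨ cong (λ v → + (a % n) -ᶻ + v) (ℕ.m≡m%n+[m/n]*n a n) ⟩
    + (a % n) -ᶻ + (a % n + a / n * n)           ≡⟨ cong (λ v → + (a % n) -ᶻ v) (ℤ.pos-+ (a % n) (a / n * n)) ⟩
    + (a % n) -ᶻ (+ (a % n) +ᶻ + (a / n * n))    ≡⟨ cong (λ v → + (a % n) -ᶻ (+ (a % n) +ᶻ v)) (ℤ.pos-* (a / n) n) ⟩
    + (a % n) -ᶻ (+ (a % n) +ᶻ + (a / n) *ᶻ + n) ≡⟨ eq (+ (a % n)) (+ (a / n)) (+ n) ⟩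
    -ᶻ + (a / n) *ᶻ + n                          ∎))
  where
    open ≡-Reasoning
    eq : ∀ r q n → r -ᶻ (r +ᶻ q *ᶻ n) ≡ -ᶻ q *ᶻ n
    eq = solve-∀

mod′-≡mod : ∀ a n .{{_ : NonZero n}} → + (a mod′ n) ≡ + a mod n
mod′-≡mod a (suc n) = %-≡mod a (suc n)

mod′-+-≡mod : ∀ a b n .{{_ : NonZero n}} → + ((a + b) mod′ n) ≡ + a +ᶻ + b mod n
mod′-+-≡mod a b n = ≡mod-trans (mod′-≡mod (a + b) n) (≡⇒≡mod (ℤ.pos-+ a b))

mod′-*-≡mod : ∀ a b n .{{_ : NonZero n}} → + ((a * b) mod′ n) ≡ + a *ᶻ + b mod n
mod′-*-≡mod a b n = ≡mod-trans (mod′-≡mod (a * b) n) (≡⇒≡mod (ℤ.pos-* a b))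

+*-≡mod : ∀ a m n → + (a + m * n) ≡ + a mod n
+*-≡mod a m n = ≡mod (divides (+ m) (trans (cong (_-ᶻ + a) (trans (ℤ.pos-+ a (m * n)) (cong (+ a +ᶻ_) (ℤ.pos-* m n))))
                                          (eq (+ a) (+ m) (+ n))))
  where
    eq : ∀ a m n → a +ᶻ m *ᶻ n -ᶻ a ≡ m *ᶻ n
    eq = solve-∀

mod′-< : ∀ a n .{{_ : NonZero n}} → a mod′ n < n
mod′-< a (suc n) = ℕ.m%n<n a (suc n)

mod′-mod′ : ∀ a m n .{{_ : NonZero m}} .{{_ : NonZero n}} → m ℕ.∣ n → (a mod′ n) mod′ m ≡ a mod′ m
mod′-mod′ a (suc m) (suc n) = ℕ.m∣n⇒o%n%m≡o%m (suc m) (suc n) a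

<⇒mod′≡ : ∀ {a} n .{{_ : NonZero n}} → a < n → a mod′ n ≡ a
<⇒mod′≡ (suc n) = ℕ.m<n⇒m%n≡m

div′-< : ∀ a n .{{_ : NonZero a}} → 1 < n → a div′ n < a
div′-< a (suc n) = ℕ.m/n<m a (suc n)

+*-mod′ : ∀ {c} s n .{{_ : NonZero n}} → c < n → (c + s * n) mod′ n ≡ c
+*-mod′ {c} s (suc n) c<n = trans (ℕ.[m+kn]%n≡m%n c s (suc n)) (ℕ.m<n⇒m%n≡m c<n)

+*-div′ : ∀ {c} s n .{{_ : NonZero n}} → c < n → (c + s * n) div′ n ≡ s
+*-div′ {c} s (suc n) c<n =
  trans (ℕ.+-distrib-/-∣ʳ c (ℕ.n∣m*n s)) (cong₂ _+_ (ℕ.m<n⇒m/n≡0 c<n) (ℕ.m*n/n≡m s (suc n)))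

<ᵇ≡true : ∀ {m n} → m < n → (m <ᵇ n) ≡ true
<ᵇ≡true {m} {n} m<n with m <ᵇ n | ℕ.<⇒<ᵇ m<n
... | true | _ = refl

<ᵇ≡false : ∀ {m n} → n ≤ m → (m <ᵇ n) ≡ false
<ᵇ≡false {m} {n} n≤m with m <ᵇ n in eq
... | false = refl
... | true  = ⊥-elim (ℕ.<⇒≱ (ℕ.<ᵇ⇒< m n (subst T (sym eq) tt)) n≤m)

∣-<⇒≡0 : ∀ {n v} .{{_ : NonZero n}} → + n ∣ + v → v < n → v ≡ 0
∣-<⇒≡0 {n} {v} d v<n = trans (sym (ℕ.m<n⇒m%n≡m v<n)) (ℕ.n∣m⇒m%n≡0 v n (∣⇒∣ᵤ d))

sqProd : ℕ → ℤ → ℤ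
sqProd zero    u = + 1
sqProd (suc l) u = sqProd l u *ᶻ ((u +ᶻ + suc l) *ᶻ (u +ᶻ + suc l))

sqProd-mono : ∀ {a b} u → a ≤ b → sqProd a u ∣ sqProd b u
sqProd-mono {a} {zero}  u z≤n = ∣-refl
sqProd-mono {a} {suc b} u a≤b+1 with ℕ.m≤n⇒m<n∨m≡n a≤b+1
... | inj₂ refl       = ∣-refl
... | inj₁ (s≤s a≤b) = ∣m⇒∣m*n _ (sqProd-mono u a≤b)

module PrimePower {p : ℕ} (pp : Prime p) where

  instance
    p-nonZero : NonZero p
    p-nonZero = prime⇒nonZero pp

  p^≢0 : ∀ k → NonZero (p ^ k)
  p^≢0 k = ℕ.m^n≢0 p k

  1<p : 1 < p
  1<p = nonTrivial⇒n>1 p {{prime⇒nonTrivial pp}}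

  p^1∣p : + (p ^ 1) ∣ + p
  p^1∣p = ∣ᵤ⇒∣ (ℕ.∣-reflexive (ℕ.*-identityʳ p))

  ^-∣-^ : ∀ {i k} → i ≤ k → p ^ i ℕ.∣ p ^ k
  ^-∣-^ {i} {k} i≤k = subst (λ e → p ^ i ℕ.∣ p ^ e) (ℕ.m+[n∸m]≡n i≤k)
    (subst (p ^ i ℕ.∣_) (sym (ℕ.^-distribˡ-+-* p i (k ∸ i))) (ℕ.m∣m*n (p ^ (k ∸ i))))

  ^-∣-weaken : ∀ {i k u} → i ≤ k → + (p ^ k) ∣ u → + (p ^ i) ∣ u
  ^-∣-weaken i≤k = ∣-trans (∣ᵤ⇒∣ (^-∣-^ i≤k))

  ^-∣-* : ∀ {a b u v} → + (p ^ a) ∣ u → + (p ^ b) ∣ v → + (p ^ (a + b)) ∣ u *ᶻ v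
  ^-∣-* {a} {b} (divides s refl) (divides t refl) = divides (s *ᶻ t) (begin
      s *ᶻ + (p ^ a) *ᶻ (t *ᶻ + (p ^ b)) ≡⟨ eq s t (+ (p ^ a)) (+ (p ^ b)) ⟩
      s *ᶻ t *ᶻ (+ (p ^ a) *ᶻ + (p ^ b)) ≡⟨ cong (s *ᶻ t *ᶻ_) (ℤ.pos-* (p ^ a) (p ^ b)) ⟨
      s *ᶻ t *ᶻ + (p ^ a * p ^ b)        ≡⟨ cong (λ e → s *ᶻ t *ᶻ + e) (ℕ.^-distribˡ-+-* p a b) ⟨
      s *ᶻ t *ᶻ + (p ^ (a + b))          ∎)
    where
      open ≡-Reasoning
      eq : ∀ s t x y → s *ᶻ x *ᶻ (t *ᶻ y) ≡ s *ᶻ t *ᶻ (x *ᶻ y)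
      eq = solve-∀

  ∤-cancel-^ᵤ : ∀ K {c d} → ¬ (p ℕ.∣ c) → p ^ K ℕ.∣ c * d → p ^ K ℕ.∣ d
  ∤-cancel-^ᵤ zero {d = d} _ _ = ℕ.1∣ d
  ∤-cancel-^ᵤ (suc K) {c} {d} p∤c p^K+1∣cd
    with euclidsLemma c d pp (ℕ.∣-trans (ℕ.m∣m*n (p ^ K)) p^K+1∣cd)
  ... | inj₁ p∣c = ⊥-elim (p∤c p∣c)
  ... | inj₂ (ℕ.divides e refl) =
    subst (p * p ^ K ℕ.∣_) (ℕ.*-comm p e)
      (ℕ.*-monoʳ-∣ p (∤-cancel-^ᵤ K p∤c (ℕ.*-cancelˡ-∣ p (subst (p * p ^ K ℕ.∣_) (reassoc c e) p^K+1∣cd))))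
    where
      reassoc : ∀ c e → c * (e * p) ≡ p * (c * e)
      reassoc c e = trans (sym (ℕ.*-assoc c e p)) (ℕ.*-comm (c * e) p)

  ∤-cancel-^ : ∀ K {c d} → ¬ (+ p ∣ c) → + (p ^ K) ∣ c *ᶻ d → + (p ^ K) ∣ d
  ∤-cancel-^ K {c} {d} p∤c p^K∣cd = ∣ᵤ⇒∣
    (∤-cancel-^ᵤ K (λ p∣c → p∤c (∣ᵤ⇒∣ p∣c)) (subst (p ^ K ℕ.∣_) (ℤ.abs-* c d) (∣⇒∣ᵤ p^K∣cd)))

  *-≡mod-^-suc : ∀ {r a b x} → a ≡ b mod p → + (p ^ r) ∣ x → a *ᶻ x ≡ b *ᶻ x mod p ^ suc r
  *-≡mod-^-suc {r} {a} {b} {x} (≡mod p∣a-b) p^r∣x =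
    ≡mod (subst (_ ∣_) (eq a b x) (^-∣-* {1} {r} (∣-trans p^1∣p p∣a-b) p^r∣x))
    where
      eq : ∀ a b x → (a -ᶻ b) *ᶻ x ≡ a *ᶻ x -ᶻ b *ᶻ x
      eq = solve-∀

  residue-≡mod : ∀ {x} → ValidZp p x → ∀ {i K} → i ≤ K → + x K ≡ + x i mod p ^ i
  residue-≡mod {x} valid {i} {zero} z≤n = ≡mod-refl
  residue-≡mod {x} valid {i} {suc K} i≤K+1 with ℕ.m≤n⇒m<n∨m≡n i≤K+1
  ... | inj₂ refl = ≡mod-refl
  ... | inj₁ (s≤s i≤K) = ≡mod-trans (≡mod-weaken (^-∣-^ i≤K) step) (residue-≡mod valid i≤K)
    where
      step : + x (suc K) ≡ + x K mod p ^ K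
      step = subst (λ e → + x (suc K) ≡ + e mod p ^ K) (proj₂ (valid K))
                   (≡mod-sym (mod′-≡mod (x (suc K)) (p ^ K) {{p^≢0 K}}))

  InPowIdeal⇒∣ : ∀ {x} → ValidZp p x → ∀ {i K} → i ≤ K → InPowIdeal p i x → + (p ^ i) ∣ + x K
  InPowIdeal⇒∣ {x} valid {i} {K} i≤K xᵢ≡0 =
    ≡mod0⇒∣ (subst (λ e → + x K ≡ + e mod p ^ i) xᵢ≡0 (residue-≡mod valid i≤K))

  ∣⇒InPowIdeal : ∀ {x} → ValidZp p x → ∀ K → + (p ^ K) ∣ + x K → InPowIdeal p K x
  ∣⇒InPowIdeal valid K p^K∣x = ∣-<⇒≡0 {{p^≢0 K}} p^K∣x (proj₁ (valid K))

  IsUnit⇒∤ : ∀ {x} → ValidZp p x → ∀ {K} → 1 ≤ K → IsUnit p x → ¬ (+ p ∣ + x K)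
  IsUnit⇒∤ valid 1≤K unit p∣x = unit (∣⇒InPowIdeal valid 1
    (≡mod0⇒∣ (≡mod-trans (≡mod-sym (residue-≡mod valid 1≤K)) (∣⇒≡mod0 (∣-trans p^1∣p p∣x)))))

  ιₚ-valid : ∀ j → ValidZp p (ιₚ p j)
  ιₚ-valid j k = mod′-< j (p ^ k) {{p^≢0 k}} , mod′-mod′ j (p ^ k) (p ^ suc k) {{p^≢0 k}} {{p^≢0 (suc k)}} (ℕ.n∣m*n p)

  ιₚ-unit : ∀ {j} → 1 ≤ j → j < p → IsUnit p (ιₚ p j)
  ιₚ-unit {j} 1≤j j<p j≡0 = ℕ.<⇒≢ 1≤j (sym (trans (sym (<⇒mod′≡ (p ^ 1) {{p^≢0 1}} j<p^1)) j≡0))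
    where
      j<p^1 : j < p ^ 1
      j<p^1 = subst (j <_) (sym (ℕ.*-identityʳ p)) j<p

  -- The hypothesis places the t multiples (x / p + 1) p, …, (x / p + t) p of p among
  -- x + 1, …, x + l; each of them contributes p² to the product.
  p^2t∣sqProd : ∀ t x l → (x / p + t) * p ≤ x + l → + (p ^ (t + t)) ∣ sqProd l (+ x)
  p^2t∣sqProd zero    x l _    = divides (sqProd l (+ x)) (sym (ℤ.*-identityʳ _))
  p^2t∣sqProd (suc t) x l cond = ^-∣-weaken (ℕ.≤-reflexive (exponent t))
      (∣-trans (^-∣-* {t + t} {1 + 1} (p^2t∣sqProd t x l₁ cond′) (^-∣-* {1} {1} p∣y p∣y)) (sqProd-mono (+ x) l₁+1≤l))
    where
      exponent : ∀ t → suc t + suc t ≡ t + t + (1 + 1)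
      exponent = ℕ-solve-∀
      w = (x / p + t) * p
      y = (x / p + suc t) * p
      y≡p+w : y ≡ p + w
      y≡p+w = cong (_* p) (ℕ.+-suc (x / p) t)
      x<y : x < y
      x<y = begin-strict
        x                        ≡⟨ ℕ.m≡m%n+[m/n]*n x p ⟩
        x % p + x / p * p        <⟨ ℕ.+-monoˡ-< (x / p * p) (ℕ.m%n<n x p) ⟩
        p + x / p * p            ≤⟨ ℕ.+-monoʳ-≤ p (ℕ.*-monoˡ-≤ p (ℕ.m≤m+n (x / p) t)) ⟩
        p + w                    ≡⟨ y≡p+w ⟨
        y                        ∎
        where open ℕ.≤-Reasoning
      l₁ = y ∸ suc x
      x+l₁+1≡y : x + suc l₁ ≡ y
      x+l₁+1≡y = trans (ℕ.+-suc x l₁) (ℕ.m+[n∸m]≡n x<y)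
      l₁+1≤l : suc l₁ ≤ l
      l₁+1≤l = ℕ.+-cancelˡ-≤ x (suc l₁) l (subst (_≤ x + l) (sym x+l₁+1≡y) cond)
      cond′ : w ≤ x + l₁
      cond′ = ℕ.≤-pred (subst (w <_) (trans (sym y≡p+w) (trans (sym x+l₁+1≡y) (ℕ.+-suc x l₁)))
                               (ℕ.m<n+m w (ℕ.<-trans z<s 1<p)))
      p∣y : + (p ^ 1) ∣ + x +ᶻ + suc l₁
      p∣y = ∣-trans p^1∣p (divides (+ (x / p + suc t)) (trans (sym (ℤ.pos-+ x (suc l₁)))
              (trans (cong +_ x+l₁+1≡y) (ℤ.pos-* (x / p + suc t) p))))

module Evaluation {p : ℕ} (pp : Prime p) where

  open PrimePower pp

  evalℤ : ℕ → Poly p → ℤ → ℤ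
  evalℤ L []       u = + 0
  evalℤ L (c ∷ cs) u = + c L +ᶻ u *ᶻ evalℤ L cs u

  evalℤ-cong : ∀ {n} L cs {u v} → u ≡ v mod n → evalℤ L cs u ≡ evalℤ L cs v mod n
  evalℤ-cong L []       u≡v = ≡mod-refl
  evalℤ-cong L (c ∷ cs) u≡v = +-congˡ-mod (+ c L) (*-cong-mod u≡v (evalℤ-cong L cs u≡v))

  evalℤ-level : ∀ {i K} cs → ValidPoly p cs → i ≤ K → ∀ u → evalℤ K cs u ≡ evalℤ i cs u mod p ^ i
  evalℤ-level []       _              i≤K u = ≡mod-refl
  evalℤ-level (c ∷ cs) (c-valid , cs-valid) i≤K u =
    +-cong-mod (residue-≡mod c-valid i≤K) (*-congˡ-mod u (evalℤ-level cs cs-valid i≤K u))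

  evalℤ-zero : ∀ L cs → (∀ j → coeff p cs j L ≡ 0) → ∀ u → evalℤ L cs u ≡ + 0
  evalℤ-zero L []       h u = refl
  evalℤ-zero L (c ∷ cs) h u =
    cong₂ _+ᶻ_ (cong +_ (h 0)) (trans (cong (u *ᶻ_) (evalℤ-zero L cs (λ j → h (suc j)) u)) (ℤ.*-zeroʳ u))

  evalℤ-coeff : ∀ L cs ds → (∀ j → coeff p cs j L ≡ coeff p ds j L) → ∀ u → evalℤ L cs u ≡ evalℤ L ds u
  evalℤ-coeff L []       ds       h u = sym (evalℤ-zero L ds (λ j → sym (h j)) u)
  evalℤ-coeff L (c ∷ cs) []       h u = evalℤ-zero L (c ∷ cs) h u
  evalℤ-coeff L (c ∷ cs) (d ∷ ds) h u =
    cong₂ _+ᶻ_ (cong +_ (h 0)) (cong (u *ᶻ_) (evalℤ-coeff L cs ds (λ j → h (suc j)) u))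

  module _ (L : ℕ) where

    private instance
      p^L≢0 : NonZero (p ^ L)
      p^L≢0 = p^≢0 L

    open SetoidReasoning (≡mod-setoid (p ^ L))

    evalP-≡mod : ∀ cs u → + evalP p cs u L ≡ evalℤ L cs (+ u L) mod p ^ L
    evalP-≡mod []       u = ≡mod-refl
    evalP-≡mod (c ∷ cs) u = begin
      + ((c L + (u L * evalP p cs u L) mod′ (p ^ L)) mod′ (p ^ L)) ≈⟨ mod′-+-≡mod (c L) _ (p ^ L) ⟩
      + c L +ᶻ + ((u L * evalP p cs u L) mod′ (p ^ L))            ≈⟨ +-congˡ-mod (+ c L) (mod′-*-≡mod (u L) _ (p ^ L)) ⟩
      + c L +ᶻ + u L *ᶻ + evalP p cs u L                        ≈⟨ +-congˡ-mod (+ c L) (*-congˡ-mod (+ u L) (evalP-≡mod cs u)) ⟩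
      evalℤ L (c ∷ cs) (+ u L)                                  ∎

    applyPθ-≡mod : ∀ cs f n → + applyPθ p cs f n L ≡ evalℤ L cs (+ n) *ᶻ + f n L mod p ^ L
    applyPθ-≡mod []       f n = ≡⇒≡mod (sym (ℤ.*-zeroˡ (+ f n L)))
    applyPθ-≡mod (c ∷ cs) f n = begin
      + applyPθ p (c ∷ cs) f n L
        ≈⟨ mod′-+-≡mod ((c L * f n L) mod′ (p ^ L)) ((n mod′ (p ^ L) * applyPθ p cs f n L) mod′ (p ^ L)) (p ^ L) ⟩
      + ((c L * f n L) mod′ (p ^ L)) +ᶻ + ((n mod′ (p ^ L) * applyPθ p cs f n L) mod′ (p ^ L))
        ≈⟨ +-cong-mod (mod′-*-≡mod (c L) (f n L) (p ^ L)) (mod′-*-≡mod (n mod′ (p ^ L)) _ (p ^ L)) ⟩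
      + c L *ᶻ + f n L +ᶻ + (n mod′ (p ^ L)) *ᶻ + applyPθ p cs f n L
        ≈⟨ +-congˡ-mod (+ c L *ᶻ + f n L) (*-cong-mod (mod′-≡mod n (p ^ L)) (applyPθ-≡mod cs f n)) ⟩
      + c L *ᶻ + f n L +ᶻ + n *ᶻ (evalℤ L cs (+ n) *ᶻ + f n L)
        ≡⟨ eq (+ c L) (+ f n L) (+ n) (evalℤ L cs (+ n)) ⟩
      evalℤ L (c ∷ cs) (+ n) *ᶻ + f n L ∎
      where
        eq : ∀ c f n e → c *ᶻ f +ᶻ n *ᶻ (e *ᶻ f) ≡ (c +ᶻ n *ᶻ e) *ᶻ f
        eq = solve-∀

    evalℤ-addP : ∀ cs ds u → evalℤ L (addP p cs ds) u ≡ evalℤ L cs u +ᶻ evalℤ L ds u mod p ^ L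
    evalℤ-addP []       ds       u = ≡⇒≡mod (sym (ℤ.+-identityˡ _))
    evalℤ-addP (c ∷ cs) []       u = ≡⇒≡mod (sym (ℤ.+-identityʳ _))
    evalℤ-addP (c ∷ cs) (d ∷ ds) u = begin
      + ((c L + d L) mod′ (p ^ L)) +ᶻ u *ᶻ evalℤ L (addP p cs ds) u
        ≈⟨ +-cong-mod (mod′-+-≡mod (c L) (d L) (p ^ L)) (*-congˡ-mod u (evalℤ-addP cs ds u)) ⟩
      + c L +ᶻ + d L +ᶻ u *ᶻ (evalℤ L cs u +ᶻ evalℤ L ds u)
        ≡⟨ eq (+ c L) (+ d L) u (evalℤ L cs u) (evalℤ L ds u) ⟩
      evalℤ L (c ∷ cs) u +ᶻ evalℤ L (d ∷ ds) u ∎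
      where
        eq : ∀ a b u x y → a +ᶻ b +ᶻ u *ᶻ (x +ᶻ y) ≡ (a +ᶻ u *ᶻ x) +ᶻ (b +ᶻ u *ᶻ y)
        eq = solve-∀

    evalℤ-scale : ∀ a ds u → evalℤ L (map (_*ₚ_ p a) ds) u ≡ + a L *ᶻ evalℤ L ds u mod p ^ L
    evalℤ-scale a []       u = ≡⇒≡mod (sym (ℤ.*-zeroʳ (+ a L)))
    evalℤ-scale a (d ∷ ds) u = begin
      + ((a L * d L) mod′ (p ^ L)) +ᶻ u *ᶻ evalℤ L (map (_*ₚ_ p a) ds) u
        ≈⟨ +-cong-mod (mod′-*-≡mod (a L) (d L) (p ^ L)) (*-congˡ-mod u (evalℤ-scale a ds u)) ⟩
      + a L *ᶻ + d L +ᶻ u *ᶻ (+ a L *ᶻ evalℤ L ds u)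
        ≡⟨ eq (+ a L) (+ d L) u (evalℤ L ds u) ⟩
      + a L *ᶻ evalℤ L (d ∷ ds) u ∎
      where
        eq : ∀ a b u x → a *ᶻ b +ᶻ u *ᶻ (a *ᶻ x) ≡ a *ᶻ (b +ᶻ u *ᶻ x)
        eq = solve-∀

    evalℤ-mulP : ∀ cs ds u → evalℤ L (mulP p cs ds) u ≡ evalℤ L cs u *ᶻ evalℤ L ds u mod p ^ L
    evalℤ-mulP []       ds u = ≡⇒≡mod (sym (ℤ.*-zeroˡ (evalℤ L ds u)))
    evalℤ-mulP (c ∷ cs) ds u = begin
      evalℤ L (addP p (map (_*ₚ_ p c) ds) (0ₚ ∷ mulP p cs ds)) u
        ≈⟨ evalℤ-addP (map (_*ₚ_ p c) ds) (0ₚ ∷ mulP p cs ds) u ⟩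
      evalℤ L (map (_*ₚ_ p c) ds) u +ᶻ (+ 0 +ᶻ u *ᶻ evalℤ L (mulP p cs ds) u)
        ≈⟨ +-cong-mod (evalℤ-scale c ds u) (+-congˡ-mod (+ 0) (*-congˡ-mod u (evalℤ-mulP cs ds u))) ⟩
      + c L *ᶻ evalℤ L ds u +ᶻ (+ 0 +ᶻ u *ᶻ (evalℤ L cs u *ᶻ evalℤ L ds u))
        ≡⟨ eq (+ c L) u (evalℤ L cs u) (evalℤ L ds u) ⟩
      evalℤ L (c ∷ cs) u *ᶻ evalℤ L ds u ∎
      where
        eq : ∀ c u x y → c *ᶻ y +ᶻ (+ 0 +ᶻ u *ᶻ (x *ᶻ y)) ≡ (c +ᶻ u *ᶻ x) *ᶻ y
        eq = solve-∀

    evalℤ-X+ : ∀ i u → evalℤ L (X+ p i) u ≡ u +ᶻ + i mod p ^ L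
    evalℤ-X+ i u = begin
      + (i mod′ (p ^ L)) +ᶻ u *ᶻ (+ (1 mod′ (p ^ L)) +ᶻ u *ᶻ + 0)
        ≈⟨ +-cong-mod (mod′-≡mod i (p ^ L)) (*-congˡ-mod u (+-congʳ-mod (u *ᶻ + 0) (mod′-≡mod 1 (p ^ L)))) ⟩
      + i +ᶻ u *ᶻ (+ 1 +ᶻ u *ᶻ + 0)
        ≡⟨ eq (+ i) u ⟩
      u +ᶻ + i ∎
      where
        eq : ∀ i u → i +ᶻ u *ᶻ (+ 1 +ᶻ u *ᶻ + 0) ≡ u +ᶻ i
        eq = solve-∀

    evalℤ-one : ∀ u → evalℤ L (1ₚ p ∷ []) u ≡ + 1 mod p ^ L
    evalℤ-one u = ≡mod-trans (+-congʳ-mod (u *ᶻ + 0) (mod′-≡mod 1 (p ^ L))) (≡⇒≡mod (cong (+ 1 +ᶻ_) (ℤ.*-zeroʳ u)))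

    evalℤ-prodSq : ∀ k u → evalℤ L (prodSq p k) u ≡ sqProd (k ∸ 1) u mod p ^ L
    evalℤ-prodSq zero          u = evalℤ-one u
    evalℤ-prodSq (suc zero)    u = evalℤ-one u
    evalℤ-prodSq (suc (suc k)) u = begin
      evalℤ L (mulP p (prodSq p (suc k)) (mulP p (X+ p (suc k)) (X+ p (suc k)))) u
        ≈⟨ evalℤ-mulP (prodSq p (suc k)) _ u ⟩
      evalℤ L (prodSq p (suc k)) u *ᶻ evalℤ L (mulP p (X+ p (suc k)) (X+ p (suc k))) u
        ≈⟨ *-cong-mod (evalℤ-prodSq (suc k) u) (evalℤ-mulP (X+ p (suc k)) (X+ p (suc k)) u) ⟩
      sqProd k u *ᶻ (evalℤ L (X+ p (suc k)) u *ᶻ evalℤ L (X+ p (suc k)) u)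
        ≈⟨ *-congˡ-mod (sqProd k u) (*-cong-mod (evalℤ-X+ (suc k) u) (evalℤ-X+ (suc k) u)) ⟩
      sqProd (suc k) u ∎

    evalℤ-divides : ∀ ds cs → DividesP p ds cs →
                    Σ (Poly p) λ qs → ∀ u → evalℤ L cs u ≡ evalℤ L ds u *ᶻ evalℤ L qs u mod p ^ L
    evalℤ-divides ds cs (qs , _ , cs≈ds*qs) =
      qs , λ u → ≡mod-trans (≡⇒≡mod (evalℤ-coeff L cs (mulP p ds qs) (λ j → cs≈ds*qs j L) u)) (evalℤ-mulP ds qs u)

  evalP-< : ∀ cs u L → evalP p cs u L < p ^ L
  evalP-< []       u L = ℕ.m^n>0 p L
  evalP-< (c ∷ cs) u L = mod′-< _ (p ^ L) {{p^≢0 L}}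

  PreservesUnits⇒∤ : ∀ {cs} → ValidPoly p cs → PreservesUnits p cs →
                     ∀ {K j} → 1 ≤ K → 1 ≤ j → j < p → ¬ (+ p ∣ evalℤ K cs (+ j))
  PreservesUnits⇒∤ {cs} cs-valid preserves {K} {j} 1≤K 1≤j j<p p∣cs[j] =
    preserves (ιₚ p j) (ιₚ-valid j) (ιₚ-unit 1≤j j<p)
      (∣-<⇒≡0 {{p^≢0 1}} (≡mod0⇒∣ value≡0) (evalP-< cs (ιₚ p j) 1))
    where
      value≡0 : + evalP p cs (ιₚ p j) 1 ≡ + 0 mod p ^ 1
      value≡0 = ≡mod-trans (evalP-≡mod 1 cs (ιₚ p j))
        (≡mod-trans (evalℤ-cong 1 cs (mod′-≡mod j (p ^ 1) {{p^≢0 1}}))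
          (≡mod-trans (≡mod-sym (evalℤ-level cs cs-valid 1≤K (+ j))) (∣⇒≡mod0 (∣-trans p^1∣p p∣cs[j]))))

module Digits {p : ℕ} (pp : Prime p) (A : ℕ → Zp) (A₀-unit : IsUnit p (A 0)) where

  open PrimePower pp using (p-nonZero; 1<p)

  χ𝒵 : ℕ → ℕ
  χ𝒵 d = length (filter (λ d → A d 1 ≟ 0) (d ∷ []))

  private
    count𝒵 : List ℕ → ℕ
    count𝒵 ds = length (filter (λ d → A d 1 ≟ 0) ds)

  count𝒵-∷ : ∀ d ds → count𝒵 (d ∷ ds) ≡ χ𝒵 d + count𝒵 ds
  count𝒵-∷ d ds with A d 1 ≡ᵇ 0
  ... | true  = refl
  ... | false = refl

  χ𝒵≤1 : ∀ d → χ𝒵 d ≤ 1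
  χ𝒵≤1 d with A d 1 ≡ᵇ 0
  ... | true  = s≤s z≤n
  ... | false = z≤n

  χ𝒵-∈ : ∀ {d} → InPowIdeal p 1 (A d) → χ𝒵 d ≡ 1
  χ𝒵-∈ A[d]≡0 rewrite A[d]≡0 = refl

  χ𝒵-0 : χ𝒵 0 ≡ 0
  χ𝒵-0 with A 0 1 ≡ᵇ 0 in eq
  ... | true  = ⊥-elim (A₀-unit (ℕ.≡ᵇ⇒≡ (A 0 1) 0 (subst T (sym eq) tt)))
  ... | false = refl

  div′p< : ∀ {n} → p ≤ n → n div′ p < n
  div′p< {n} p≤n = div′-< n p {{>-nonZero (ℕ.<-≤-trans (ℕ.<-trans z<s 1<p) p≤n)}} 1<p

  digitsFuel-< : ∀ f {n} → n < p → digitsFuel p (suc f) n ≡ n ∷ []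
  digitsFuel-< f n<p rewrite <ᵇ≡true n<p = refl

  digitsFuel-≥ : ∀ f {n} → p ≤ n → digitsFuel p (suc f) n ≡ n mod′ p ∷ digitsFuel p f (n div′ p)
  digitsFuel-≥ f p≤n rewrite <ᵇ≡false p≤n = refl

  digitsFuel-enough : ∀ f g n → n < f → n < g → digitsFuel p f n ≡ digitsFuel p g n
  digitsFuel-enough (suc f) (suc g) n n<f n<g with ℕ.<-≤-connex n p
  ... | inj₁ n<p = trans (digitsFuel-< f n<p) (sym (digitsFuel-< g n<p))
  ... | inj₂ p≤n = begin
    digitsFuel p (suc f) n                       ≡⟨ digitsFuel-≥ f p≤n ⟩
    n mod′ p ∷ digitsFuel p f (n div′ p)         ≡⟨ cong (n mod′ p ∷_) (digitsFuel-enough f g (n div′ p) (shrink n<f) (shrink n<g)) ⟩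
    n mod′ p ∷ digitsFuel p g (n div′ p)         ≡⟨ digitsFuel-≥ g p≤n ⟨
    digitsFuel p (suc g) n                       ∎
    where
      open ≡-Reasoning
      shrink : ∀ {h} → n < suc h → n div′ p < h
      shrink n<h+1 = ℕ.<-≤-trans (div′p< p≤n) (ℕ.≤-pred n<h+1)

  digits-≥ : ∀ {n} → p ≤ n → digits p n ≡ n mod′ p ∷ digits p (n div′ p)
  digits-≥ {n} p≤n =
    trans (digitsFuel-≥ n p≤n) (cong (n mod′ p ∷_) (digitsFuel-enough n (suc (n div′ p)) (n div′ p) (div′p< p≤n) ℕ.≤-refl))

  α-0 : α p A 0 ≡ 0
  α-0 = trans (cong count𝒵 (digitsFuel-< 0 (ℕ.<-trans z<s 1<p))) χ𝒵-0

  α-digit : ∀ {c} s → c < p → α p A (c + s * p) ≡ χ𝒵 c + α p A s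
  α-digit {c} zero c<p = begin
    α p A (c + 0)                  ≡⟨ cong (α p A) (ℕ.+-identityʳ c) ⟩
    count𝒵 (digitsFuel p (suc c) c) ≡⟨ cong count𝒵 (digitsFuel-< c c<p) ⟩
    χ𝒵 c                           ≡⟨ ℕ.+-identityʳ (χ𝒵 c) ⟨
    χ𝒵 c + 0                       ≡⟨ cong (λ a → χ𝒵 c + a) α-0 ⟨
    χ𝒵 c + α p A 0                 ∎
    where open ≡-Reasoning
  α-digit {c} s@(suc _) c<p = begin
    count𝒵 (digits p n)                            ≡⟨ cong count𝒵 (digits-≥ p≤n) ⟩
    count𝒵 (n mod′ p ∷ digits p (n div′ p))        ≡⟨ count𝒵-∷ (n mod′ p) (digits p (n div′ p)) ⟩
    χ𝒵 (n mod′ p) + α p A (n div′ p)               ≡⟨ cong₂ (λ d s → χ𝒵 d + α p A s) (+*-mod′ s p c<p) (+*-div′ s p c<p) ⟩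
    χ𝒵 c + α p A s                                 ∎
    where
      open ≡-Reasoning
      n = c + s * p
      p≤n : p ≤ n
      p≤n = ℕ.≤-trans (ℕ.m≤m+n p _) (ℕ.m≤n+m (s * p) c)

  α-≤-digit : ∀ {c} s → c < p → α p A s ≤ α p A (c + s * p)
  α-≤-digit {c} s c<p = subst (α p A s ≤_) (sym (α-digit s c<p)) (ℕ.m≤n+m (α p A s) (χ𝒵 c))

  α-suc : ∀ m → α p A (suc m) ≤ suc (α p A m)
  α-suc = <-rec (λ m → α p A (suc m) ≤ suc (α p A m)) step
    where
      open ℕ.≤-Reasoning
      step : ∀ m → (∀ {y} → y < m → α p A (suc y) ≤ suc (α p A y)) → α p A (suc m) ≤ suc (α p A m)
      step m ih with m % p | ℕ.m%n<n m p | ℕ.m≡m%n+[m/n]*n m p | suc (m % p) ℕ.<? p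
      ... | c | c<p | m≡c+sp | yes c+1<p = begin
        α p A (suc m)             ≡⟨ cong (α p A ∘ suc) m≡c+sp ⟩
        α p A (suc c + s * p)     ≡⟨ α-digit s c+1<p ⟩
        χ𝒵 (suc c) + α p A s      ≤⟨ ℕ.+-monoˡ-≤ (α p A s) (χ𝒵≤1 (suc c)) ⟩
        suc (α p A s)             ≤⟨ s≤s (α-≤-digit s c<p) ⟩
        suc (α p A (c + s * p))   ≡⟨ cong (suc ∘ α p A) m≡c+sp ⟨
        suc (α p A m)             ∎
        where s = m / p
      ... | c | c<p | m≡c+sp | no c+1≮p = begin
        α p A (suc m)             ≡⟨ cong (α p A ∘ suc) m≡c+sp ⟩
        α p A (suc c + s * p)     ≡⟨ cong (λ d → α p A (d + s * p)) c+1≡p ⟩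
        α p A (0 + suc s * p)     ≡⟨ α-digit (suc s) (ℕ.<-trans z<s 1<p) ⟩
        χ𝒵 0 + α p A (suc s)      ≡⟨ cong (_+ α p A (suc s)) χ𝒵-0 ⟩
        α p A (suc s)             ≤⟨ ih s<m ⟩
        suc (α p A s)             ≤⟨ s≤s (α-≤-digit s c<p) ⟩
        suc (α p A (c + s * p))   ≡⟨ cong (suc ∘ α p A) m≡c+sp ⟨
        suc (α p A m)             ∎
        where
          s = m / p
          c+1≡p : suc c ≡ p
          c+1≡p = ℕ.≤-antisym c<p (ℕ.≮⇒≥ c+1≮p)
          1≤m : 1 ≤ m
          1≤m = subst (1 ≤_) (sym m≡c+sp)
                  (ℕ.≤-trans (ℕ.≤-pred (subst (1 <_) (sym c+1≡p) 1<p)) (ℕ.m≤m+n c (s * p)))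
          s<m : s < m
          s<m = ℕ.m/n<m m p {{>-nonZero 1≤m}} 1<p

  α-+ : ∀ n t → α p A (n + t) ≤ α p A n + t
  α-+ n zero    = ℕ.≤-reflexive (trans (cong (α p A) (ℕ.+-identityʳ n)) (sym (ℕ.+-identityʳ _)))
  α-+ n (suc t) = begin
    α p A (n + suc t)     ≡⟨ cong (α p A) (ℕ.+-suc n t) ⟩
    α p A (suc (n + t))   ≤⟨ α-suc (n + t) ⟩
    suc (α p A (n + t))   ≤⟨ s≤s (α-+ n t) ⟩
    suc (α p A n + t)     ≡⟨ ℕ.+-suc (α p A n) t ⟨
    α p A n + suc t       ∎
    where open ℕ.≤-Reasoning

sum≤ : ℕ → (ℕ → ℤ) → ℤ
sum≤ zero    g = g 0
sum≤ (suc q) g = sum≤ q g +ᶻ g (suc q)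

sum≤-cong : ∀ {n} q {g h} → (∀ k → k ≤ q → g k ≡ h k mod n) → sum≤ q g ≡ sum≤ q h mod n
sum≤-cong zero    g≡h = g≡h 0 z≤n
sum≤-cong (suc q) g≡h = +-cong-mod (sum≤-cong q (λ k k≤q → g≡h k (ℕ.m≤n⇒m≤1+n k≤q))) (g≡h (suc q) ℕ.≤-refl)

sum≤-linear : ∀ q a b g h → sum≤ q (λ k → a *ᶻ g k -ᶻ b *ᶻ h k) ≡ a *ᶻ sum≤ q g -ᶻ b *ᶻ sum≤ q h
sum≤-linear zero    a b g h = refl
sum≤-linear (suc q) a b g h =
  trans (cong (_+ᶻ (a *ᶻ g (suc q) -ᶻ b *ᶻ h (suc q))) (sum≤-linear q a b g h))
        (eq (sum≤ q g) (sum≤ q h) a b (g (suc q)) (h (suc q)))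
  where
    eq : ∀ s t a b x y → (a *ᶻ s -ᶻ b *ᶻ t) +ᶻ (a *ᶻ x -ᶻ b *ᶻ y) ≡ a *ᶻ (s +ᶻ x) -ᶻ b *ᶻ (t +ᶻ y)
    eq = solve-∀

sum≤-head : ∀ {n} q g → (∀ k → 1 ≤ k → k ≤ q → g k ≡ + 0 mod n) → sum≤ q g ≡ g 0 mod n
sum≤-head zero    g tail≡0 = ≡mod-refl
sum≤-head (suc q) g tail≡0 = ≡mod-trans
  (+-cong-mod (sum≤-head q g (λ k 1≤k k≤q → tail≡0 k 1≤k (ℕ.m≤n⇒m≤1+n k≤q)))
              (tail≡0 (suc q) (s≤s z≤n) ℕ.≤-refl))
  (≡⇒≡mod (ℤ.+-identityʳ (g 0)))

-- With E k x standing for P_k(x), recSum q E Z n is the coefficient of z^n in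
-- Σ_{k ≤ q} z^k P_k(θ) applied to Σ_n Z n z^n.
recTerm : (ℕ → ℕ → ℤ) → (ℕ → ℤ) → ℕ → ℕ → ℤ
recTerm E Z k n = if n <ᵇ k then + 0 else E k (n ∸ k) *ᶻ Z (n ∸ k)

recSum : ℕ → (ℕ → ℕ → ℤ) → (ℕ → ℤ) → ℕ → ℤ
recSum q E Z n = sum≤ q (λ k → recTerm E Z k n)

recTerm-< : ∀ E Z {k n} → n < k → recTerm E Z k n ≡ + 0
recTerm-< E Z n<k rewrite <ᵇ≡true n<k = refl

recTerm-≥ : ∀ E Z {k n} → k ≤ n → recTerm E Z k n ≡ E k (n ∸ k) *ᶻ Z (n ∸ k)
recTerm-≥ E Z k≤n rewrite <ᵇ≡false k≤n = refl

proportional : ∀ {p} → Prime p → ∀ K q (E : ℕ → ℕ → ℤ) (X Y : ℕ → ℤ) →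
  (∀ {j} → 1 ≤ j → j < p → ¬ (+ p ∣ E 0 j)) →
  (∀ {j} → 1 ≤ j → j < p → recSum q E X j ≡ + 0 mod p ^ K) →
  (∀ {j} → 1 ≤ j → j < p → recSum q E Y j ≡ + 0 mod p ^ K) →
  ∀ j → j < p → X j *ᶻ Y 0 ≡ X 0 *ᶻ Y j mod p ^ K
proportional {p} pp K q E X Y E₀-unit X-rec Y-rec = <-rec (λ j → j < p → Proportional j) step
  where
    open PrimePower pp using (∤-cancel-^)

    Proportional : ℕ → Set
    Proportional j = X j *ᶻ Y 0 ≡ X 0 *ᶻ Y j mod p ^ K

    zero-combination : ∀ a b → a *ᶻ + 0 -ᶻ b *ᶻ + 0 ≡ + 0
    zero-combination = solve-∀

    -- mixedTerm j 0 = E 0 j (X j Y 0 − X 0 Y j); the other terms vanish by induction.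
    mixedTerm : ℕ → ℕ → ℤ
    mixedTerm j k = Y 0 *ᶻ recTerm E X k j -ᶻ X 0 *ᶻ recTerm E Y k j

    mixedSum-≡0 : ∀ {j} → 1 ≤ j → j < p → sum≤ q (mixedTerm j) ≡ + 0 mod p ^ K
    mixedSum-≡0 {j} 1≤j j<p = ≡mod-trans (≡⇒≡mod (sum≤-linear q (Y 0) (X 0) _ _))
      (≡mod-trans (+-cong-mod (*-congˡ-mod (Y 0) (X-rec 1≤j j<p)) (neg-cong-mod (*-congˡ-mod (X 0) (Y-rec 1≤j j<p))))
                  (≡⇒≡mod (zero-combination (Y 0) (X 0))))

    mixedTerm-≡0 : ∀ {j} → (∀ {i} → i < j → Proportional i) → ∀ k → 1 ≤ k → mixedTerm j k ≡ + 0 mod p ^ K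
    mixedTerm-≡0 {j} ih k 1≤k with ℕ.<-≤-connex j k
    ... | inj₁ j<k rewrite recTerm-< E X j<k | recTerm-< E Y j<k = ≡⇒≡mod (zero-combination (Y 0) (X 0))
    ... | inj₂ k≤j rewrite recTerm-≥ E X k≤j | recTerm-≥ E Y k≤j =
      ≡mod-trans (≡⇒≡mod (eq (E k i) (X i) (Y 0) (X 0) (Y i)))
                 (≡mod-trans (*-congˡ-mod (E k i) (∣⇒≡mod0 (∣-diff (ih (ℕ.∸-monoʳ-< 1≤k k≤j)))))
                             (≡⇒≡mod (ℤ.*-zeroʳ (E k i))))
      where
        i = j ∸ k
        eq : ∀ e x y₀ x₀ y → y₀ *ᶻ (e *ᶻ x) -ᶻ x₀ *ᶻ (e *ᶻ y) ≡ e *ᶻ (x *ᶻ y₀ -ᶻ x₀ *ᶻ y)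
        eq = solve-∀

    step : ∀ j → (∀ {i} → i < j → i < p → Proportional i) → j < p → Proportional j
    step zero    _  _   = ≡mod-refl
    step j@(suc _) ih j<p = ≡mod (∤-cancel-^ K (E₀-unit (s≤s z≤n) j<p) (≡mod0⇒∣ leading≡0))
      where
        leading≡0 : E 0 j *ᶻ (X j *ᶻ Y 0 -ᶻ X 0 *ᶻ Y j) ≡ + 0 mod p ^ K
        leading≡0 = ≡mod-trans (≡⇒≡mod (eq (E 0 j) (X j) (Y 0) (X 0) (Y j)))
          (≡mod-trans (≡mod-sym (sum≤-head q (mixedTerm j) (λ k 1≤k _ → mixedTerm-≡0 ih′ k 1≤k)))
                      (mixedSum-≡0 (s≤s z≤n) j<p))
          where
            eq : ∀ e x y₀ x₀ y → e *ᶻ (x *ᶻ y₀ -ᶻ x₀ *ᶻ y) ≡ y₀ *ᶻ (e *ᶻ x) -ᶻ x₀ *ᶻ (e *ᶻ y)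
            eq = solve-∀
            ih′ : ∀ {i} → i < j → Proportional i
            ih′ i<j = ih i<j (ℕ.<-trans i<j j<p)

module Operator {p : ℕ} (pp : Prime p) (A : ℕ → Zp) (A-valid : ∀ n → ValidZp p (A n))
                (q : ℕ) (P : ℕ → Poly p) (annihilates : Annihilates p q P A) where

  open PrimePower pp
  open Evaluation pp

  E : ℕ → ℕ → ℕ → ℤ
  E K k x = evalℤ K (P k) (+ x)

  Y : ℕ → ℕ → ℤ
  Y K n = + A n K

  zpow-≡mod : ∀ K k n → + zpow p k (applyPθ p (P k) A) n K ≡ recTerm (E K) (Y K) k n mod p ^ K
  zpow-≡mod K k n with n <ᵇ k
  ... | true  = ≡mod-refl
  ... | false = applyPθ-≡mod K (P k) A (n ∸ k)

  applyL-≡mod : ∀ K q′ n → + applyL p q′ P A n K ≡ recSum q′ (E K) (Y K) n mod p ^ K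
  applyL-≡mod K zero     n = zpow-≡mod K 0 n
  applyL-≡mod K (suc q′) n =
    ≡mod-trans (mod′-+-≡mod (applyL p q′ P A n K) (zpow p (suc q′) (applyPθ p (P (suc q′)) A) n K) (p ^ K) {{p^≢0 K}})
               (+-cong-mod (applyL-≡mod K q′ n) (zpow-≡mod K (suc q′) n))

  annihilation-recurrence : ∀ K n → recSum q (E K) (Y K) n ≡ + 0 mod p ^ K
  annihilation-recurrence K n = ≡mod-trans (≡mod-sym (applyL-≡mod K q n)) (≡⇒≡mod (cong +_ (annihilates n K)))

  -- The terms of the recurrence at j + m p that reach below the block m p, …, m p + p − 1.
  CrossTermsVanish : ℕ → ℕ → Set
  CrossTermsVanish r m = ∀ {j k} → 1 ≤ j → j < p → j < k → k ≤ q → k ≤ j + m * p →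
    E (suc r) k (j + m * p ∸ k) *ᶻ Y (suc r) (j + m * p ∸ k) ≡ + 0 mod p ^ suc r

  shifted-recurrence : ∀ r m → (∀ {i} → i < p → + (p ^ r) ∣ Y (suc r) (i + m * p)) → CrossTermsVanish r m →
    ∀ {j} → 1 ≤ j → j < p → recSum q (E (suc r)) (λ i → Y (suc r) (i + m * p)) j ≡ + 0 mod p ^ suc r
  shifted-recurrence r m p^r∣block cross {j} 1≤j j<p =
    ≡mod-trans (sum≤-cong q termwise) (annihilation-recurrence (suc r) (j + m * p))
    where
      K = suc r
      X : ℕ → ℤ
      X i = Y K (i + m * p)
      termwise : ∀ k → k ≤ q → recTerm (E K) X k j ≡ recTerm (E K) (Y K) k (j + m * p) mod p ^ K
      termwise k k≤q with ℕ.<-≤-connex j k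
      ... | inj₂ k≤j
        rewrite recTerm-≥ (E K) X k≤j | recTerm-≥ (E K) (Y K) (ℕ.≤-trans k≤j (ℕ.m≤m+n j (m * p))) | ℕ.+-∸-comm (m * p) k≤j =
          ≡mod-sym (*-≡mod-^-suc {r} (evalℤ-cong K (P k) (+*-≡mod (j ∸ k) m p))
                                     (p^r∣block (ℕ.≤-<-trans (ℕ.m∸n≤m j k) j<p)))
      ... | inj₁ j<k with ℕ.<-≤-connex (j + m * p) k
      ...   | inj₁ n<k rewrite recTerm-< (E K) X j<k | recTerm-< (E K) (Y K) n<k = ≡mod-refl
      ...   | inj₂ k≤n rewrite recTerm-< (E K) X j<k | recTerm-≥ (E K) (Y K) k≤n = ≡mod-sym (cross 1≤j j<p j<k k≤q k≤n)

  module _ (A₀-unit : IsUnit p (A 0)) (r : ℕ)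
           (α-divides : ∀ n i → i ≤ r → i ≤ α p A n → + (p ^ i) ∣ Y (suc r) n) where

    open Digits pp A A₀-unit

    -- Only j = 1, k = 2 and m ≥ 1 occur; then x = m p − 1 has last digit p − 1 ∈ 𝒵 and x + 1 = m p.
    typeII⇒crossTermsVanish : TypeII p q P → InZ p A (p ∸ 1) → ∀ m → r ≤ α p A m → CrossTermsVanish r m
    typeII⇒crossTermsVanish (q≡2 , _ , X+1∣P₂) (_ , p-1∈𝒵) m r≤αm 1≤j _ j<k k≤q =
      vanish m r≤αm 1≤j j<k (subst (_ ≤_) q≡2 k≤q)
      where
        K = suc r
        vanish : ∀ {j k} m → r ≤ α p A m → 1 ≤ j → j < k → k ≤ 2 → k ≤ j + m * p →
                 E K k (j + m * p ∸ k) *ᶻ Y K (j + m * p ∸ k) ≡ + 0 mod p ^ K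
        vanish {1}           {1}                 _        _    _ (s≤s ())            _              _
        vanish {1}           {suc (suc (suc _))} _        _    _ _                   (s≤s (s≤s ())) _
        vanish {suc (suc _)} {_}                 _        _    _ (s≤s (s≤s (s≤s _))) (s≤s (s≤s ())) _
        vanish {1}           {2}                 zero     _    _ _                   _              (s≤s ())
        vanish {1}           {2}                 (suc m′) r≤αm _ _                   _              _ =
          subst (λ y → E K 2 y *ᶻ Y K y ≡ + 0 mod p ^ K) (sym x≡) (factor-≡mod0 (+ x +ᶻ + 1) E₂≡ p^K∣)
          where
            x = p ∸ 1 + m′ * p
            1≤p = ℕ.<⇒≤ 1<p
            x≡ : p + m′ * p ∸ 1 ≡ x
            x≡ = ℕ.+-∸-comm (m′ * p) 1≤p
            x+1≡ : x + 1 ≡ suc m′ * p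
            x+1≡ = trans (ℕ.+-comm x 1) (cong (_+ m′ * p) (ℕ.m+[n∸m]≡n 1≤p))
            Q = proj₁ (evalℤ-divides K (X+ p 1) (P 2) X+1∣P₂)
            E₂≡ : E K 2 x ≡ (+ x +ᶻ + 1) *ᶻ evalℤ K Q (+ x) mod p ^ K
            E₂≡ = ≡mod-trans (proj₂ (evalℤ-divides K (X+ p 1) (P 2) X+1∣P₂) (+ x))
                             (*-cong-mod (evalℤ-X+ K 1 (+ x)) (≡mod-refl {a = evalℤ K Q (+ x)}))
            p∣x+1 : + (p ^ 1) ∣ + x +ᶻ + 1
            p∣x+1 = ∣-trans p^1∣p (divides (+ suc m′)
                      (trans (sym (ℤ.pos-+ x 1)) (trans (cong +_ x+1≡) (ℤ.pos-* (suc m′) p))))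
            r≤αx : r ≤ α p A x
            r≤αx = begin
              r                        ≤⟨ r≤αm ⟩
              α p A (suc m′)           ≤⟨ α-suc m′ ⟩
              suc (α p A m′)           ≡⟨ cong (_+ α p A m′) (χ𝒵-∈ p-1∈𝒵) ⟨
              χ𝒵 (p ∸ 1) + α p A m′    ≡⟨ α-digit m′ (ℕ.∸-monoʳ-< z<s 1≤p) ⟨
              α p A x                  ∎
              where open ℕ.≤-Reasoning
            p^K∣ : + (p ^ K) ∣ (+ x +ᶻ + 1) *ᶻ Y K x
            p^K∣ = ^-∣-* {1} {r} p∣x+1 (α-divides x r ℕ.≤-refl r≤αx)

    -- With s = x / p and t = m − s, the factor sqProd (k − 1) x supplies p^(2t), while α x ≥ α m − t.
    typeI⇒crossTermsVanish : TypeI p q P → ∀ m → r ≤ α p A m → CrossTermsVanish r m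
    typeI⇒crossTermsVanish (_ , prodSq∣P) m r≤αm {j} {k@(suc l)} 1≤j _ j<k k≤q k≤n =
      factor-≡mod0 (sqProd l (+ x)) Eₖ≡ p^K∣
      where
        K = suc r
        x = j + m * p ∸ k
        2≤k : 2 ≤ k
        2≤k = s≤s (ℕ.≤-trans 1≤j (ℕ.≤-pred j<k))
        Q = proj₁ (evalℤ-divides K (prodSq p k) (P k) (prodSq∣P k 2≤k k≤q))
        Eₖ≡ : E K k x ≡ sqProd l (+ x) *ᶻ evalℤ K Q (+ x) mod p ^ K
        Eₖ≡ = ≡mod-trans (proj₂ (evalℤ-divides K (prodSq p k) (P k) (prodSq∣P k 2≤k k≤q)) (+ x))
                         (*-cong-mod (evalℤ-prodSq K k (+ x)) (≡mod-refl {a = evalℤ K Q (+ x)}))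
        x+k≡ : x + k ≡ j + m * p
        x+k≡ = ℕ.m∸n+n≡m k≤n
        x<mp : x < m * p
        x<mp = ℕ.+-cancelʳ-< k x (m * p) (begin-strict
          x + k            ≡⟨ x+k≡ ⟩
          j + m * p        <⟨ ℕ.+-monoˡ-< (m * p) j<k ⟩
          k + m * p        ≡⟨ ℕ.+-comm k (m * p) ⟩
          m * p + k        ∎)
          where open ℕ.≤-Reasoning
        s = x / p
        s<m : s < m
        s<m = ℕ.m<n*o⇒m/o<n x<mp
        t = m ∸ s
        1≤t : 1 ≤ t
        1≤t = ℕ.m<n⇒0<n∸m s<m
        s+t≡m : s + t ≡ m
        s+t≡m = ℕ.m+[n∸m]≡n (ℕ.<⇒≤ s<m)
        mp≤x+l : (s + t) * p ≤ x + l
        mp≤x+l = ℕ.≤-pred (begin-strict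
          (s + t) * p      ≡⟨ cong (_* p) s+t≡m ⟩
          m * p            <⟨ ℕ.+-monoˡ-≤ (m * p) 1≤j ⟩
          j + m * p        ≡⟨ x+k≡ ⟨
          x + suc l        ≡⟨ ℕ.+-suc x l ⟩
          suc (x + l)      ∎)
          where open ℕ.≤-Reasoning
        αm≤αx+t : α p A m ≤ α p A x + t
        αm≤αx+t = begin
          α p A m              ≡⟨ cong (α p A) s+t≡m ⟨
          α p A (s + t)        ≤⟨ α-+ s t ⟩
          α p A s + t          ≤⟨ ℕ.+-monoˡ-≤ t (α-≤-digit s (ℕ.m%n<n x p)) ⟩
          α p A (x % p + s * p) + t ≡⟨ cong (λ y → α p A y + t) (ℕ.m≡m%n+[m/n]*n x p) ⟨
          α p A x + t          ∎
          where open ℕ.≤-Reasoning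
        divisible : ∀ i → + (p ^ i) ∣ Y K x → suc r ≤ t + t + i → + (p ^ K) ∣ sqProd l (+ x) *ᶻ Y K x
        divisible i p^i∣Y r<2t+i = ^-∣-weaken r<2t+i (^-∣-* {t + t} {i} (p^2t∣sqProd t x l mp≤x+l) p^i∣Y)
        p^K∣ : + (p ^ K) ∣ sqProd l (+ x) *ᶻ Y K x
        p^K∣ with ℕ.≤-<-connex r (α p A x)
        ... | inj₁ r≤αx =
          divisible r (α-divides x r ℕ.≤-refl r≤αx) (ℕ.+-monoˡ-≤ r (ℕ.≤-trans 1≤t (ℕ.m≤m+n t t)))
        ... | inj₂ αx<r = divisible (α p A x) (α-divides x (α p A x) (ℕ.<⇒≤ αx<r) ℕ.≤-refl) (begin
          suc r                  ≤⟨ s≤s (ℕ.≤-trans r≤αm αm≤αx+t) ⟩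
          suc (α p A x + t)      ≡⟨ cong suc (ℕ.+-comm (α p A x) t) ⟩
          1 + (t + α p A x)      ≤⟨ ℕ.+-monoˡ-≤ (t + α p A x) 1≤t ⟩
          t + (t + α p A x)      ≡⟨ ℕ.+-assoc t t (α p A x) ⟨
          t + t + α p A x        ∎)
          where open ℕ.≤-Reasoning

lemma1 : (p : ℕ) → Prime p → (A : ℕ → Zp) → ((n : ℕ) → ValidZp p (A n)) →
         LucasProperty p A → IsUnit p (A 0) →
         (q : ℕ) → (P : ℕ → Poly p) → ((k : ℕ) → k ≤ q → ValidPoly p (P k)) →
         Annihilates p q P A →
         (TypeI p q P ⊎ (TypeII p q P × InZ p A (p ∸ 1))) →
         (r : ℕ) →
         ((n i : ℕ) → i ≤ r → α p A n ≥ i → InPowIdeal p i (A n)) →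
         (n₀ : ℕ) → InZ p A n₀ → (m : ℕ) → α p A m ≥ r →
         InPowIdeal p (suc r) (A (n₀ + m * p))
lemma1 p pp A A-valid _ A₀-unit q P P-valid annihilates type r hyp n₀ (n₀<p , n₀∈𝒵) m r≤αm =
  ∣⇒InPowIdeal (A-valid (n₀ + m * p)) K (∤-cancel-^ K Y₀-unit (≡mod0⇒∣ Y₀Xn₀≡0))
  where
    open PrimePower pp
    open Evaluation pp using (PreservesUnits⇒∤)
    open Digits pp A A₀-unit using (α-≤-digit)
    open Operator pp A A-valid q P annihilates

    K = suc r

    X : ℕ → ℤ
    X i = Y K (i + m * p)

    α-divides : ∀ n i → i ≤ r → i ≤ α p A n → + (p ^ i) ∣ Y K n
    α-divides n i i≤r i≤αn = InPowIdeal⇒∣ (A-valid n) (ℕ.m≤n⇒m≤1+n i≤r) (hyp n i i≤r i≤αn)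

    p^r∣X : ∀ {i} → i < p → + (p ^ r) ∣ X i
    p^r∣X {i} i<p = α-divides (i + m * p) r ℕ.≤-refl (ℕ.≤-trans r≤αm (α-≤-digit m i<p))

    cross : CrossTermsVanish r m
    cross = [ (λ typeI → typeI⇒crossTermsVanish A₀-unit r α-divides typeI m r≤αm)
            , (λ (typeII , p-1∈𝒵) → typeII⇒crossTermsVanish A₀-unit r α-divides typeII p-1∈𝒵 m r≤αm) ]′ type

    P₀-preserves-units : PreservesUnits p (P 0)
    P₀-preserves-units = [ proj₁ , (λ (typeII , _) → proj₁ (proj₂ typeII)) ]′ type

    Xn₀Y₀≡X₀Yn₀ : X n₀ *ᶻ Y K 0 ≡ X 0 *ᶻ Y K n₀ mod p ^ K
    Xn₀Y₀≡X₀Yn₀ = proportional pp K q (E K) X (Y K)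
      (PreservesUnits⇒∤ (P-valid 0 z≤n) P₀-preserves-units (s≤s z≤n))
      (shifted-recurrence r m p^r∣X cross)
      (λ _ _ → annihilation-recurrence K _)
      n₀ n₀<p

    X₀Yn₀≡0 : X 0 *ᶻ Y K n₀ ≡ + 0 mod p ^ K
    X₀Yn₀≡0 = ∣⇒≡mod0 (subst (_ ∣_) (ℤ.*-comm (Y K n₀) (X 0))
      (^-∣-* {1} {r} (InPowIdeal⇒∣ (A-valid n₀) (s≤s z≤n) n₀∈𝒵) (p^r∣X (ℕ.<-trans z<s 1<p))))

    Y₀Xn₀≡0 : Y K 0 *ᶻ X n₀ ≡ + 0 mod p ^ K
    Y₀Xn₀≡0 = ≡mod-trans (≡⇒≡mod (ℤ.*-comm (Y K 0) (X n₀))) (≡mod-trans Xn₀Y₀≡X₀Yn₀ X₀Yn₀≡0)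

    Y₀-unit : ¬ (+ p ∣ Y K 0)
    Y₀-unit = IsUnit⇒∤ (A-valid 0) (s≤s z≤n) A₀-unit
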